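{- For every implicative-disjunctive formula $A$: $\vdash_{id} A$ if and only if $\vdash_i \tau(A)$.
   Context: **Language.** Formulas are built from the atomic formulas $p_1, p_2, \dots$ using binary connectives. - Implicative-disjunctive formulas use only $\to$ and $\vee$. - Implicative formulas use only $\to$. Iterated connectives associate to the right: $A \to B \to C$ means $A \to (B \to C)$. **Implicative translation.** The implicative translation $\tau(A)$ of an implicative-disjunctive formula $A$ is the implicative formula obtained from $A$ by repeatedly replacing subformulas of the form $B \vee C$ by $(B \to C) \to C$. Equivalently, $\tau$ is defined recursively by: - $\tau(p)=p$ for atomic $p$; - $\tau(B \to C) = \tau(B) \to \tau(C)$; - $\tau(B \vee C) = (\tau(B) \to \tau(C)) \to \tau(C)$. **Calculi.** $\vdash_i$ denotes thesishood in the classical implicative propositional calculus. Its language is the implicative formulas and its axiom schemes are: - (Ax1) $A \to B \to A$; - (Ax2) $(A \to B \to C) \to (A \to B) \to A \to C$; - (Ax3) $((A \to B) \to A) \to A$. Its only rule is modus ponens. $\vdash_{id}$ denotes thesishood in the classical implicative-disjunctive propositional calculus. Its language is the implicative-disjunctive formulas, and its axiom schemes are (Ax1)–(Ax3) together with: - (Ax4) $A \to (A \vee B)$; - (Ax5) $A \to (B \vee A)$; - (Ax6) $(A \to C) \to (B \to C) \to (A \vee B) \to C$. Its only rule is modus ponens. -}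

module Defs where

open import Data.Nat using (ℕ)

data IFm : Set where
  atomᵢ : ℕ → IFm
  _⇒ᵢ_  : IFm → IFm → IFm

infixr 20 _⇒ᵢ_

data IDFm : Set where
  atom : ℕ → IDFm
  _⇒_  : IDFm → IDFm → IDFm
  _∨_  : IDFm → IDFm → IDFm

infixr 20 _⇒_
infixr 25 _∨_

τ : IDFm → IFm
τ (atom n) = atomᵢ n
τ (A ⇒ B)  = τ A ⇒ᵢ τ B
τ (A ∨ B)  = (τ A ⇒ᵢ τ B) ⇒ᵢ τ B

data ⊢ᵢ_ : IFm → Set where
  ax1 : ∀ A B → ⊢ᵢ (A ⇒ᵢ B ⇒ᵢ A)
  ax2 : ∀ A B C → ⊢ᵢ ((A ⇒ᵢ B ⇒ᵢ C) ⇒ᵢ (A ⇒ᵢ B) ⇒ᵢ A ⇒ᵢ C)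
  ax3 : ∀ A B → ⊢ᵢ (((A ⇒ᵢ B) ⇒ᵢ A) ⇒ᵢ A)
  mp  : ∀ {A B} → ⊢ᵢ (A ⇒ᵢ B) → ⊢ᵢ A → ⊢ᵢ B

data ⊢id_ : IDFm → Set where
  ax1 : ∀ A B → ⊢id (A ⇒ B ⇒ A)
  ax2 : ∀ A B C → ⊢id ((A ⇒ B ⇒ C) ⇒ (A ⇒ B) ⇒ A ⇒ C)
  ax3 : ∀ A B → ⊢id (((A ⇒ B) ⇒ A) ⇒ A)
  ax4 : ∀ A B → ⊢id (A ⇒ (A ∨ B))
  ax5 : ∀ A B → ⊢id (A ⇒ (B ∨ A))
  ax6 : ∀ A B C → ⊢id ((A ⇒ C) ⇒ (B ⇒ C) ⇒ (A ∨ B) ⇒ C)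
  mp  : ∀ {A B} → ⊢id (A ⇒ B) → ⊢id A → ⊢id B

infix 5 ⊢ᵢ_ ⊢id_

-- τ sends Ax4 and Ax5 to the introduction rules of the implicative disjunction
-- B ∨̇ C = (B → C) → C, which hold in any calculus with Ax1 and Ax2, and Ax6 to its
-- elimination rule, which holds by Peirce's law; as τ commutes with modus ponens,
-- ⊢id A gives ⊢ᵢ τ A. Conversely ⊢ᵢ embeds into ⊢id, where B ∨ C and B ∨̇ C are
-- interderivable (ax6 one way, Peirce's law the other), so by induction on A the
-- formulas A and τ A are interderivable in ⊢id.
module Submission where

open import Defs
open import Function.Bundles using (_⇔_; mk⇔)
open import Data.List using (List; []; _∷_)
open import Data.List.Membership.Propositional using (_∈_)
open import Data.List.Relation.Unary.Any using (here; there)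
open import Relation.Binary.PropositionalEquality using (refl)

module Hilbert (F : Set) (_⊃_ : F → F → F) (Thm : F → Set)
  (K  : ∀ A B → Thm (A ⊃ (B ⊃ A)))
  (S  : ∀ A B C → Thm ((A ⊃ (B ⊃ C)) ⊃ ((A ⊃ B) ⊃ (A ⊃ C))))
  (MP : ∀ {A B} → Thm (A ⊃ B) → Thm A → Thm B) where

  infix 4 _⊢_

  data _⊢_ (Γ : List F) : F → Set where
    hyp : ∀ {A} → A ∈ Γ → Γ ⊢ A
    thm : ∀ {A} → Thm A → Γ ⊢ A
    app : ∀ {A B} → Γ ⊢ (A ⊃ B) → Γ ⊢ A → Γ ⊢ B

  #0 : ∀ {Γ A} → A ∷ Γ ⊢ A
  #0 = hyp (here refl)

  #1 : ∀ {Γ A B} → B ∷ A ∷ Γ ⊢ A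
  #1 = hyp (there (here refl))

  #2 : ∀ {Γ A B C} → C ∷ B ∷ A ∷ Γ ⊢ A
  #2 = hyp (there (there (here refl)))

  #4 : ∀ {Γ A B C D E} → E ∷ D ∷ C ∷ B ∷ A ∷ Γ ⊢ A
  #4 = hyp (there (there (there (there (here refl)))))

  ⊃-refl : ∀ A → Thm (A ⊃ A)
  ⊃-refl A = MP (MP (S A (A ⊃ A) A) (K A (A ⊃ A))) (K A A)

  deduction : ∀ {Γ A B} → A ∷ Γ ⊢ B → Γ ⊢ (A ⊃ B)
  deduction (hyp (here refl)) = thm (⊃-refl _)
  deduction (hyp (there p))   = app (thm (K _ _)) (hyp p)
  deduction (thm t)           = app (thm (K _ _)) (thm t)
  deduction (app f x)         = app (app (thm (S _ _ _)) (deduction f)) (deduction x)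

  closed : ∀ {A} → [] ⊢ A → Thm A
  closed (hyp ())
  closed (thm t)   = t
  closed (app f x) = MP (closed f) (closed x)

  ⊃-trans : ∀ {A B C} → Thm (A ⊃ B) → Thm (B ⊃ C) → Thm (A ⊃ C)
  ⊃-trans f g = closed (deduction (app (thm g) (app (thm f) #0)))

  ⊃-mono : ∀ {A A′ B B′} → Thm (A′ ⊃ A) → Thm (B ⊃ B′) → Thm ((A ⊃ B) ⊃ (A′ ⊃ B′))
  ⊃-mono f g = closed (deduction (deduction (app (thm g) (app #1 (app (thm f) #0)))))

  infixr 25 _∨̇_

  _∨̇_ : F → F → F
  A ∨̇ B = (A ⊃ B) ⊃ B

  ∨̇-introˡ : ∀ A B → Thm (A ⊃ (A ∨̇ B))
  ∨̇-introˡ A B = closed (deduction (deduction (app #0 #1)))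

  ∨̇-introʳ : ∀ A B → Thm (B ⊃ (A ∨̇ B))
  ∨̇-introʳ A B = K B (A ⊃ B)

  module Classical (peirce : ∀ A B → Thm (((A ⊃ B) ⊃ A) ⊃ A)) where

    -- Under C ⊃ B, the first case turns A into B, so A ∨̇ B yields B and then C;
    -- hence (C ⊃ B) ⊃ C, and Peirce's law gives C.
    ∨̇-elim : ∀ A B C → Thm ((A ⊃ C) ⊃ ((B ⊃ C) ⊃ ((A ∨̇ B) ⊃ C)))
    ∨̇-elim A B C = closed (deduction (deduction (deduction
      (app (thm (peirce C B))
        (deduction (app #2 (app #1 (deduction (app #1 (app #4 #0))))))))))

module Hᵢ = Hilbert IFm _⇒ᵢ_ ⊢ᵢ_ ax1 ax2 mp
module Hid = Hilbert IDFm _⇒_ ⊢id_ ax1 ax2 mp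

τ-preserves-⊢ : ∀ {A} → ⊢id A → ⊢ᵢ τ A
τ-preserves-⊢ (ax1 A B)   = ax1 _ _
τ-preserves-⊢ (ax2 A B C) = ax2 _ _ _
τ-preserves-⊢ (ax3 A B)   = ax3 _ _
τ-preserves-⊢ (ax4 A B)   = Hᵢ.∨̇-introˡ _ _
τ-preserves-⊢ (ax5 A B)   = Hᵢ.∨̇-introʳ _ _
τ-preserves-⊢ (ax6 A B C) = Hᵢ.Classical.∨̇-elim ax3 _ _ _
τ-preserves-⊢ (mp f x)    = mp (τ-preserves-⊢ f) (τ-preserves-⊢ x)

⌜_⌝ : IFm → IDFm
⌜ atomᵢ n ⌝ = atom n
⌜ A ⇒ᵢ B ⌝  = ⌜ A ⌝ ⇒ ⌜ B ⌝

⌜⌝-preserves-⊢ : ∀ {A} → ⊢ᵢ A → ⊢id ⌜ A ⌝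
⌜⌝-preserves-⊢ (ax1 A B)   = ax1 _ _
⌜⌝-preserves-⊢ (ax2 A B C) = ax2 _ _ _
⌜⌝-preserves-⊢ (ax3 A B)   = ax3 _ _
⌜⌝-preserves-⊢ (mp f x)    = mp (⌜⌝-preserves-⊢ f) (⌜⌝-preserves-⊢ x)

module _ where
  open Hid

  ∨⇒∨̇ : ∀ A B → ⊢id (A ∨ B ⇒ A ∨̇ B)
  ∨⇒∨̇ A B = mp (mp (ax6 _ _ _) (∨̇-introˡ A B)) (∨̇-introʳ A B)

  -- Under A ∨ B ⇒ B, the formula A implies B, so A ∨̇ B yields B and then A ∨ B;
  -- Peirce's law discharges the assumption.
  ∨̇⇒∨ : ∀ A B → ⊢id (A ∨̇ B ⇒ A ∨ B)
  ∨̇⇒∨ A B = closed (deduction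
    (app (thm (ax3 (A ∨ B) B))
      (deduction (app (thm (ax5 B A))
        (app #1 (deduction (app #1 (app (thm (ax4 A B)) #0))))))))

  ⇒-⌜τ⌝ : ∀ A → ⊢id (A ⇒ ⌜ τ A ⌝)
  ⌜τ⌝-⇒ : ∀ A → ⊢id (⌜ τ A ⌝ ⇒ A)

  ⇒-⌜τ⌝ (atom n) = ⊃-refl _
  ⇒-⌜τ⌝ (A ⇒ B)  = ⊃-mono (⌜τ⌝-⇒ A) (⇒-⌜τ⌝ B)
  ⇒-⌜τ⌝ (A ∨ B)  = ⊃-trans (∨⇒∨̇ A B) (⊃-mono (⊃-mono (⇒-⌜τ⌝ A) (⌜τ⌝-⇒ B)) (⇒-⌜τ⌝ B))

  ⌜τ⌝-⇒ (atom n) = ⊃-refl _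
  ⌜τ⌝-⇒ (A ⇒ B)  = ⊃-mono (⇒-⌜τ⌝ A) (⌜τ⌝-⇒ B)
  ⌜τ⌝-⇒ (A ∨ B)  = ⊃-trans (⊃-mono (⊃-mono (⌜τ⌝-⇒ A) (⇒-⌜τ⌝ B)) (⌜τ⌝-⇒ B)) (∨̇⇒∨ A B)

τ-reflects-⊢ : ∀ A → ⊢ᵢ τ A → ⊢id A
τ-reflects-⊢ A t = mp (⌜τ⌝-⇒ A) (⌜⌝-preserves-⊢ t)

mainTheorem7 : (A : IDFm) → (⊢id A) ⇔ (⊢ᵢ τ A)
mainTheorem7 A = mk⇔ τ-preserves-⊢ (τ-reflects-⊢ A)
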